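{- Let $G$ be a finite group and let $G'\subseteq G\wr S_2$ be an admissible subgroup that is good. Then the abelianization of $G'$ is isomorphic to $S_2$ (cyclic of order $2$).
   Context: $G\wr S_2=(G\times G)\rtimes S_2$ with generator $\sigma$ of $S_2$ swapping the factors, elements $(g_1,g_2,s)$, $\pi:G\wr S_2\to S_2$ the projection. A subgroup $G'$ is admissible if (i) $(1,1,\sigma)\in G'$, (ii) $G'$ is generated by its order-$2$ elements not in $\ker\pi$, (iii) $G'\cap\ker\pi$ surjects onto the first factor $G$. $G'$ is good if the order-$2$ elements of $G'\setminus\ker\pi$ form a single conjugacy class of $G'$. -}

module Defs where

open import Level using (Level; _⊔_) renaming (suc to lsuc)
open import Algebra.Bundles using (Group)
open import Data.Bool using (Bool; true; false; not; _xor_)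
open import Data.Product using (Σ; ∃; _×_; _,_)
open import Data.Fin using (Fin)
open import Data.Nat using (ℕ)
open import Data.List using (List; []; _∷_; foldr; map)
open import Data.List.Relation.Unary.All using (All)
open import Relation.Binary.PropositionalEquality using (_≡_)
open import Relation.Nullary using (¬_)

record IsFiniteGroup {c ℓ} (G : Group c ℓ) : Set (c ⊔ ℓ) where
  open Group G
  field
    size      : ℕ
    enum      : Fin size → Carrier
    enum-surj : ∀ g → ∃ λ i → enum i ≈ g

-- S₂ is represented by Bool
-- (false = identity, true = σ, composition = xor).
-- Multiplication: (a , s)(b , t) = (a · s(b) , s t), where σ swaps factors.
module WreathS2 {c ℓ} (G : Group c ℓ) where
  open Group G renaming (Carrier to A; _≈_ to _≈ᴳ_; _∙_ to _·_; ε to e; _⁻¹ to inv)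

  W : Set c
  W = A × A × Bool

  infixl 7 _∙_
  infix 4 _≈_

  _∙_ : W → W → W
  (g₁ , g₂ , false) ∙ (h₁ , h₂ , t) = (g₁ · h₁ , g₂ · h₂ , t)
  (g₁ , g₂ , true)  ∙ (h₁ , h₂ , t) = (g₁ · h₂ , g₂ · h₁ , not t)

  ε : W
  ε = (e , e , false)

  _⁻¹ : W → W
  (g₁ , g₂ , false) ⁻¹ = (inv g₁ , inv g₂ , false)
  (g₁ , g₂ , true)  ⁻¹ = (inv g₂ , inv g₁ , true)

  _≈_ : W → W → Set ℓ
  (g₁ , g₂ , s) ≈ (h₁ , h₂ , t) = (g₁ ≈ᴳ h₁) × (g₂ ≈ᴳ h₂) × (s ≡ t)

  π : W → Bool
  π (_ , _ , s) = s

  σ̂ : W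
  σ̂ = (e , e , true)

  prod : List W → W
  prod = foldr _∙_ ε

  record Subgroup (p : Level) : Set (c ⊔ ℓ ⊔ lsuc p) where
    field
      _∈H     : W → Set p
      resp-≈  : ∀ {x y} → x ≈ y → x ∈H → y ∈H
      ε-∈     : ε ∈H
      ∙-∈     : ∀ {x y} → x ∈H → y ∈H → (x ∙ y) ∈H
      ⁻¹-∈    : ∀ {x} → x ∈H → (x ⁻¹) ∈H
  open Subgroup public

  module _ {p : Level} (H : Subgroup p) where
    private
      _∈'_ : W → Subgroup p → Set p
      x ∈' K = Subgroup._∈H K x

    HasOrder2 : W → Set ℓ
    HasOrder2 x = (x ∙ x ≈ ε) × ¬ (x ≈ ε)

    Refl : W → Set (ℓ ⊔ p)
    Refl x = (x ∈' H) × HasOrder2 x × (π x ≡ true)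

    record Admissible : Set (c ⊔ ℓ ⊔ p) where
      field
        σ-∈       : σ̂ ∈' H
        generated : ∀ x → x ∈' H → ∃ λ (xs : List W) → All Refl xs × (prod xs ≈ x)
        surj₁     : ∀ (g : A) → ∃ λ (g₂ : A) → (g , g₂ , false) ∈' H

    -- good: the order-2 elements of H ∖ ker π form exactly one conjugacy
    -- class of H, i.e. they are exactly the H-conjugates of some x ∈ H.
    Good : Set (c ⊔ ℓ ⊔ p)
    Good = ∃ λ (x : W) → (x ∈' H) ×
             (∀ y → (Refl y → ∃ λ z → (z ∈' H) × (y ≈ z ∙ x ∙ z ⁻¹))
                  × ((∃ λ z → (z ∈' H) × (y ≈ z ∙ x ∙ z ⁻¹)) → Refl y))

    comm : W × W → W
    comm (a , b) = a ⁻¹ ∙ b ⁻¹ ∙ a ∙ b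

    -- membership in the commutator subgroup [H , H]: a finite product of
    -- commutators of elements of H (this set is closed under inverses since
    -- [a , b]⁻¹ = [b , a]).
    InComm : W → Set (c ⊔ ℓ ⊔ p)
    InComm x = ∃ λ (ps : List (W × W)) →
                 All (λ ab → (Data.Product.proj₁ ab ∈' H) × (Data.Product.proj₂ ab ∈' H)) ps
                 × (prod (map comm ps) ≈ x)

    -- H^ab = H / [H , H] is isomorphic to S₂ ≅ (Bool , xor): there is a map
    -- f : H → Bool which is a homomorphism, descends to a well-defined and
    -- injective map on cosets x [H,H] (f x ≡ f y ⇔ x⁻¹ y ∈ [H,H]), and is surjective.
    AbelianizationIsoS2 : Set (c ⊔ ℓ ⊔ p)
    AbelianizationIsoS2 = ∃ λ (f : W → Bool) →
        (∀ x y → x ∈' H → y ∈' H → f (x ∙ y) ≡ (f x xor f y))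
      × (∀ x y → x ∈' H → y ∈' H →
            ((f x ≡ f y) → InComm (x ⁻¹ ∙ y)) × (InComm (x ⁻¹ ∙ y) → f x ≡ f y))
      × (∀ (b : Bool) → ∃ λ x → (x ∈' H) × (f x ≡ b))

-- The isomorphism is induced by π.  Commutators lie in ker π.  Conversely,
-- by (ii) an element of ker π ∩ G' is a product of an even number of
-- reflections (order-2 elements outside ker π), and goodness makes any two
-- of them conjugate: r = a x a⁻¹ and s = b x b⁻¹ give s = d r d⁻¹ with
-- d = b a⁻¹.  As r = r⁻¹, the pair r s = r⁻¹ d r d⁻¹ is a commutator.
module Submission where

open import Defs
open import Algebra.Bundles using (Group)
open import Algebra.Structures using (IsGroup)
open import Data.Bool using (true; false; not; _xor_)
open import Data.Bool.Properties using (not-involutive; xor-same)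
open import Data.Product using (∃; _×_; _,_; proj₁)
open import Data.List using ([]; _∷_; map)
open import Data.List.Relation.Unary.All using (All; []; _∷_)
open import Relation.Binary.PropositionalEquality as ≡
  using (_≡_; refl; cong; module ≡-Reasoning)
import Algebra.Properties.Group as GroupProperties
import Relation.Binary.Reasoning.Setoid as SetoidReasoning

xor≡false⇒≡ : ∀ a b → a xor b ≡ false → a ≡ b
xor≡false⇒≡ false false _ = refl
xor≡false⇒≡ true  true  _ = refl

module Conjugation {c ℓ} (K : Group c ℓ) where
  open Group K
  open GroupProperties K
  open SetoidReasoning setoid

  conjugate-by-quotient : ∀ a b x →
    (b ∙ a ⁻¹) ∙ (a ∙ x ∙ a ⁻¹) ∙ (b ∙ a ⁻¹) ⁻¹ ≈ b ∙ x ∙ b ⁻¹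
  conjugate-by-quotient a b x = begin
    d ∙ (a ∙ x ∙ a ⁻¹) ∙ d ⁻¹   ≈⟨ ∙-congʳ (sym (assoc d (a ∙ x) (a ⁻¹))) ⟩
    d ∙ (a ∙ x) ∙ a ⁻¹ ∙ d ⁻¹   ≈⟨ assoc _ _ _ ⟩
    d ∙ (a ∙ x) ∙ (a ⁻¹ ∙ d ⁻¹) ≈⟨ ∙-cong (sym (assoc d a x)) (sym (⁻¹-anti-homo-∙ d a)) ⟩
    d ∙ a ∙ x ∙ (d ∙ a) ⁻¹      ≈⟨ ∙-cong (∙-congʳ da≈b) (⁻¹-cong da≈b) ⟩
    b ∙ x ∙ b ⁻¹                ∎
    where
    d = b ∙ a ⁻¹
    da≈b : d ∙ a ≈ b
    da≈b = begin
      b ∙ a ⁻¹ ∙ a   ≈⟨ assoc _ _ _ ⟩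
      b ∙ (a ⁻¹ ∙ a) ≈⟨ ∙-congˡ (inverseˡ a) ⟩
      b ∙ ε          ≈⟨ identityʳ b ⟩
      b              ∎

  involution-commutator : ∀ r d → r ∙ r ≈ ε →
    r ⁻¹ ∙ (d ⁻¹) ⁻¹ ∙ r ∙ d ⁻¹ ≈ r ∙ (d ∙ r ∙ d ⁻¹)
  involution-commutator r d r²≈ε = begin
    r ⁻¹ ∙ (d ⁻¹) ⁻¹ ∙ r ∙ d ⁻¹   ≈⟨ ∙-congʳ (assoc _ _ _) ⟩
    r ⁻¹ ∙ ((d ⁻¹) ⁻¹ ∙ r) ∙ d ⁻¹ ≈⟨ assoc _ _ _ ⟩
    r ⁻¹ ∙ ((d ⁻¹) ⁻¹ ∙ r ∙ d ⁻¹) ≈⟨ ∙-cong (sym (inverseˡ-unique r r r²≈ε))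
                                            (∙-congʳ (∙-congʳ (⁻¹-involutive d))) ⟩
    r ∙ (d ∙ r ∙ d ⁻¹)            ∎

  conjugate-involutions-∙ : ∀ a b x r s →
    r ≈ a ∙ x ∙ a ⁻¹ → s ≈ b ∙ x ∙ b ⁻¹ → r ∙ r ≈ ε →
    r ⁻¹ ∙ ((b ∙ a ⁻¹) ⁻¹) ⁻¹ ∙ r ∙ (b ∙ a ⁻¹) ⁻¹ ≈ r ∙ s
  conjugate-involutions-∙ a b x r s r≈ s≈ r²≈ε = begin
    r ⁻¹ ∙ (d ⁻¹) ⁻¹ ∙ r ∙ d ⁻¹ ≈⟨ involution-commutator r d r²≈ε ⟩
    r ∙ (d ∙ r ∙ d ⁻¹)          ≈⟨ ∙-congˡ (∙-congʳ (∙-congˡ r≈)) ⟩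
    r ∙ (d ∙ (a ∙ x ∙ a ⁻¹) ∙ d ⁻¹) ≈⟨ ∙-congˡ (conjugate-by-quotient a b x) ⟩
    r ∙ (b ∙ x ∙ b ⁻¹)          ≈⟨ ∙-congˡ (sym s≈) ⟩
    r ∙ s                       ∎
    where d = b ∙ a ⁻¹

module WreathGroup {c ℓ} (G : Group c ℓ) where
  open WreathS2 G
  open Group G using () renaming
    (_≈_ to _≈ᴳ_; refl to reflᴳ; sym to symᴳ; trans to transᴳ; ∙-cong to ∙ᴳ-cong;
     assoc to assocᴳ; identityˡ to identityˡᴳ; identityʳ to identityʳᴳ;
     inverseˡ to inverseˡᴳ; inverseʳ to inverseʳᴳ; ⁻¹-cong to ⁻¹ᴳ-cong)

  ≈-refl : ∀ {x} → x ≈ x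
  ≈-refl = reflᴳ , reflᴳ , refl

  ≈-sym : ∀ {x y} → x ≈ y → y ≈ x
  ≈-sym (p , q , r) = symᴳ p , symᴳ q , ≡.sym r

  ≈-trans : ∀ {x y z} → x ≈ y → y ≈ z → x ≈ z
  ≈-trans (p , q , r) (p′ , q′ , r′) = transᴳ p p′ , transᴳ q q′ , ≡.trans r r′

  ∙-cong : ∀ {x y u v} → x ≈ y → u ≈ v → x ∙ u ≈ y ∙ v
  ∙-cong {_ , _ , false} (p , q , refl) (p′ , q′ , refl) = ∙ᴳ-cong p p′ , ∙ᴳ-cong q q′ , refl
  ∙-cong {_ , _ , true}  (p , q , refl) (p′ , q′ , refl) = ∙ᴳ-cong p q′ , ∙ᴳ-cong q p′ , refl

  assoc : ∀ x y z → (x ∙ y) ∙ z ≈ x ∙ (y ∙ z)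
  assoc (_ , _ , false) (_ , _ , false) _               = assocᴳ _ _ _ , assocᴳ _ _ _ , refl
  assoc (_ , _ , false) (_ , _ , true)  _               = assocᴳ _ _ _ , assocᴳ _ _ _ , refl
  assoc (_ , _ , true)  (_ , _ , false) _               = assocᴳ _ _ _ , assocᴳ _ _ _ , refl
  assoc (_ , _ , true)  (_ , _ , true)  (_ , _ , false) = assocᴳ _ _ _ , assocᴳ _ _ _ , refl
  assoc (_ , _ , true)  (_ , _ , true)  (_ , _ , true)  = assocᴳ _ _ _ , assocᴳ _ _ _ , refl

  identityˡ : ∀ x → ε ∙ x ≈ x
  identityˡ _ = identityˡᴳ _ , identityˡᴳ _ , refl

  identityʳ : ∀ x → x ∙ ε ≈ x
  identityʳ (_ , _ , false) = identityʳᴳ _ , identityʳᴳ _ , refl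
  identityʳ (_ , _ , true)  = identityʳᴳ _ , identityʳᴳ _ , refl

  inverseˡ : ∀ x → x ⁻¹ ∙ x ≈ ε
  inverseˡ (_ , _ , false) = inverseˡᴳ _ , inverseˡᴳ _ , refl
  inverseˡ (_ , _ , true)  = inverseˡᴳ _ , inverseˡᴳ _ , refl

  inverseʳ : ∀ x → x ∙ x ⁻¹ ≈ ε
  inverseʳ (_ , _ , false) = inverseʳᴳ _ , inverseʳᴳ _ , refl
  inverseʳ (_ , _ , true)  = inverseʳᴳ _ , inverseʳᴳ _ , refl

  ⁻¹-cong : ∀ {x y} → x ≈ y → x ⁻¹ ≈ y ⁻¹
  ⁻¹-cong {_ , _ , false} (p , q , refl) = ⁻¹ᴳ-cong p , ⁻¹ᴳ-cong q , refl
  ⁻¹-cong {_ , _ , true}  (p , q , refl) = ⁻¹ᴳ-cong q , ⁻¹ᴳ-cong p , refl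

  isGroup : IsGroup _≈_ _∙_ ε _⁻¹
  isGroup = record
    { isMonoid = record
      { isSemigroup = record
        { isMagma = record
          { isEquivalence = record { refl = ≈-refl ; sym = ≈-sym ; trans = ≈-trans }
          ; ∙-cong = ∙-cong }
        ; assoc = assoc }
      ; identity = identityˡ , identityʳ }
    ; inverse = inverseˡ , inverseʳ
    ; ⁻¹-cong = ⁻¹-cong }

  group : Group c ℓ
  group = record { isGroup = isGroup }

  π-∙ : ∀ x y → π (x ∙ y) ≡ π x xor π y
  π-∙ (_ , _ , false) _ = refl
  π-∙ (_ , _ , true)  _ = refl

  π-⁻¹ : ∀ x → π (x ⁻¹) ≡ π x
  π-⁻¹ (_ , _ , false) = refl
  π-⁻¹ (_ , _ , true)  = refl

  π-cong : ∀ {x y} → x ≈ y → π x ≡ π y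
  π-cong (_ , _ , s≡t) = s≡t

  π-leftQuotient : ∀ x y → π (x ⁻¹ ∙ y) ≡ π x xor π y
  π-leftQuotient x y = ≡.trans (π-∙ (x ⁻¹) y) (cong (_xor π y) (π-⁻¹ x))

  π-commutator : ∀ a b → π (a ⁻¹ ∙ b ⁻¹ ∙ a ∙ b) ≡ false
  π-commutator (_ , _ , false) (_ , _ , false) = refl
  π-commutator (_ , _ , false) (_ , _ , true)  = refl
  π-commutator (_ , _ , true)  (_ , _ , false) = refl
  π-commutator (_ , _ , true)  (_ , _ , true)  = refl

  π-odd-∙ : ∀ {r} y → π r ≡ true → π (r ∙ y) ≡ not (π y)
  π-odd-∙ {r} y πr = ≡.trans (π-∙ r y) (cong (_xor π y) πr)

  π-odd-pair-∙ : ∀ {r s} y → π r ≡ true → π s ≡ true → π (r ∙ (s ∙ y)) ≡ π y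
  π-odd-pair-∙ {r} {s} y πr πs = begin
    π (r ∙ (s ∙ y)) ≡⟨ π-odd-∙ (s ∙ y) πr ⟩
    not (π (s ∙ y)) ≡⟨ cong not (π-odd-∙ y πs) ⟩
    not (not (π y)) ≡⟨ not-involutive (π y) ⟩
    π y             ∎
    where open ≡-Reasoning

module CommutatorSubgroup {c ℓ p} (G : Group c ℓ) (H : WreathS2.Subgroup G p) where
  open WreathS2 G
  open WreathGroup G
  open Conjugation group using (conjugate-involutions-∙)

  InComm⇒π≡false : ∀ {z} → InComm H z → π z ≡ false
  InComm⇒π≡false (ps , _ , prod≈z) = ≡.trans (≡.sym (π-cong prod≈z)) (π-prod-commutators ps)
    where
    π-prod-commutators : ∀ ps → π (prod (map (comm H) ps)) ≡ false
    π-prod-commutators []             = refl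
    π-prod-commutators ((a , b) ∷ ps) = ≡.trans (π-∙ (comm H (a , b)) _)
      (≡.cong₂ _xor_ (π-commutator a b) (π-prod-commutators ps))

  module _ (x : W) (conjugate : ∀ r → Refl H r → ∃ λ a → _∈H H a × (r ≈ a ∙ x ∙ a ⁻¹)) where

    even-reflection-product-InComm : ∀ rs → All (Refl H) rs → π (prod rs) ≡ false →
                                     InComm H (prod rs)
    even-reflection-product-InComm [] [] _ = [] , [] , ≈-refl
    even-reflection-product-InComm (r ∷ []) ((_ , _ , πr) ∷ []) π≡false
      with () ← ≡.trans (≡.sym (π-odd-∙ ε πr)) π≡false
    even-reflection-product-InComm (r ∷ s ∷ rs)
      (R@(r∈H , (r²≈ε , _) , πr) ∷ S@(_ , _ , πs) ∷ Rs) π≡false =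
      let (a , a∈H , r≈) = conjugate r R
          (b , b∈H , s≈) = conjugate s S
          (ps , Ps , prod≈) = even-reflection-product-InComm rs Rs
            (≡.trans (≡.sym (π-odd-pair-∙ (prod rs) πr πs)) π≡false)
      in ((r , (b ∙ a ⁻¹) ⁻¹) ∷ ps) ,
         ((r∈H , ⁻¹-∈ H (∙-∈ H b∈H (⁻¹-∈ H a∈H))) ∷ Ps) ,
         ≈-trans (∙-cong (conjugate-involutions-∙ a b x r s r≈ s≈ r²≈ε) prod≈)
                 (assoc r s (prod rs))

    kerπ-InComm : Admissible H → ∀ {z} → _∈H H z → π z ≡ false → InComm H z
    kerπ-InComm adm {z} z∈H πz≡false =
      let (rs , Rs , prod≈z) = Admissible.generated adm z z∈H
          (ps , Ps , prod≈) = even-reflection-product-InComm rs Rs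
                                (≡.trans (π-cong prod≈z) πz≡false)
      in ps , Ps , ≈-trans prod≈ prod≈z

lemma6p2 : ∀ {c ℓ p} (G : Group c ℓ) → IsFiniteGroup G →
    (H : WreathS2.Subgroup G p) →
    WreathS2.Admissible G H → WreathS2.Good G H →
    WreathS2.AbelianizationIsoS2 G H
lemma6p2 G _ H adm (x , _ , good) = π , (λ y z _ _ → π-∙ y z) , cosets , π-surjective
  where
  open WreathS2 G
  open WreathGroup G
  open CommutatorSubgroup G H

  cosets : ∀ y z → _∈H H y → _∈H H z →
    ((π y ≡ π z) → InComm H (y ⁻¹ ∙ z)) × (InComm H (y ⁻¹ ∙ z) → π y ≡ π z)
  cosets y z y∈H z∈H =
      (λ { refl → kerπ-InComm x (λ r R → proj₁ (good r) R) adm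
                    (∙-∈ H (⁻¹-∈ H y∈H) z∈H)
                    (≡.trans (π-leftQuotient y z) (xor-same (π y))) })
    , (λ c → xor≡false⇒≡ (π y) (π z)
               (≡.trans (≡.sym (π-leftQuotient y z)) (InComm⇒π≡false c)))

  π-surjective : ∀ b → ∃ λ w → _∈H H w × (π w ≡ b)
  π-surjective false = ε , ε-∈ H , refl
  π-surjective true  = σ̂ , Admissible.σ-∈ adm , refl
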